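{- For each positive integer $k$, let $\mathcal{SC}_k$ be the set of functions $f\in\widetilde{\mathcal{P}}_k$ such that each linear piece of $f$ is either constant or has slope $-1$. Then $|\mathcal{SC}_k| = r_{k-1}$, the $(k-1)$-st (large) Schröder number.
   Context: The class $\mathcal{P}$ consists of all functions $f:[0,1]\to[0,1]$ such that: $f$ is weakly decreasing; $f$ is piecewise linear with finitely many non-differentiable points; all non-differentiable points of $f$ are rational numbers in $[0,1]$; there is $\varepsilon>0$ with $f(x)=1$ for all $0\le x<\varepsilon$; $f(1)>0$; and for every $a\in(0,1)$, $\lim_{x\searrow a} f(x) > 1-a$. For a positive integer $k$, $\widetilde{\mathcal{P}}_k$ is the set of $f\in\mathcal{P}$ such that: $k f(i/k)\in\mathbb{Z}$ for each $i\in\{1,\ldots,k\}$; $f$ is upper-semicontinuous; and for each $i\in\{1,\ldots,k\}$ the restriction of $f$ to $((i-1)/k,i/k)$ is linear with a non-positive integer slope. The large Schröder numbers are $r_0=1, r_1=2, r_2=6, r_3=22,\ldots$ ($r_n$ counts lattice paths from $(0,0)$ to $(n,n)$ with steps $(1,0),(0,1),(1,1)$ never going above the line $y=x$).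
   Formalization: Functions in $\mathcal{P}$, $\widetilde{\mathcal{P}}_k$ and $\mathcal{SC}_k$ are defined on the rationals in $[0,1]$ and take rational values, instead of being defined on the real interval $[0,1]$. -}

module Defs where

open import Data.Nat as ℕ using (ℕ; zero; suc; NonZero; _∸_)
open import Data.Nat.Properties using (_≤?_)
open import Data.Integer as ℤ using (ℤ; +_; -[1+_])
open import Data.Rational as ℚ using (ℚ; 0ℚ; 1ℚ; _/_; _+_; _*_; _-_; ∣_∣; _≤_; _<_)
open import Data.List using (List; length)
open import Data.List.Membership.Propositional using (_∈_)
open import Data.List.Relation.Unary.All using (All)
open import Data.List.Relation.Unary.Any using (Any)
open import Data.List.Relation.Unary.AllPairs using (AllPairs)
open import Data.Product using (Σ; ∃; _×_; _,_)
open import Data.Sum using (_⊎_)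
open import Relation.Nullary using (¬_; yes; no)
open import Relation.Binary.PropositionalEquality using (_≡_)

-- Large Schröder numbers, via lattice-path counting.
-- paths a b = number of lattice paths from (0,0) to (a,b) with steps
-- (1,0), (0,1), (1,1) never going above the line y = x  (0 if b > a).

paths : ℕ → ℕ → ℕ
paths zero zero = 1
paths zero (suc b) = 0
paths (suc a) zero = paths a zero
paths (suc a) (suc b) with suc b ℕ.≤? suc a
... | yes _ = paths a (suc b) ℕ.+ paths (suc a) b ℕ.+ paths a b
... | no _ = 0

schroeder : ℕ → ℕ
schroeder n = paths n n

-- Functions [0,1] → [0,1] are represented as functions ℚ → ℚ, of which
-- only the values on ℚ ∩ [0,1] matter.

Dom : ℚ → Set
Dom x = (0ℚ ≤ x) × (x ≤ 1ℚ)

ℤtoℚ : ℤ → ℚ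
ℤtoℚ z = z / 1

Decreasing : (ℚ → ℚ) → Set
Decreasing f = ∀ x y → Dom x → Dom y → x ≤ y → f y ≤ f x

MapsInto01 : (ℚ → ℚ) → Set
MapsInto01 f = ∀ x → Dom x → (0ℚ ≤ f x) × (f x ≤ 1ℚ)

PiecewiseLinear : (ℚ → ℚ) → Set
PiecewiseLinear f =
  Σ (List ℚ) λ ps →
    ∀ x z → Dom x → Dom z → x < z →
    (∀ p → p ∈ ps → ¬ ((x ≤ p) × (p ≤ z))) →
    Σ ℚ λ m → Σ ℚ λ c → ∀ y → x ≤ y → y ≤ z → f y ≡ c + m * y

RightLimit : (ℚ → ℚ) → ℚ → ℚ → Set
RightLimit f a L =
  ∀ ε → 0ℚ < ε → Σ ℚ λ δ → (0ℚ < δ) ×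
    (∀ x → a < x → x < a + δ → x ≤ 1ℚ → ∣ f x - L ∣ < ε)

record InP (f : ℚ → ℚ) : Set where
  field
    into01      : MapsInto01 f
    decreasing  : Decreasing f
    piecewise   : PiecewiseLinear f
    oneNearZero : Σ ℚ λ ε → (0ℚ < ε) × (∀ x → 0ℚ ≤ x → x < ε → f x ≡ 1ℚ)
    positiveAt1 : 0ℚ < f 1ℚ
    rightLimits : ∀ a → 0ℚ < a → a < 1ℚ →
                  Σ ℚ λ L → RightLimit f a L × (1ℚ - a < L)

grid : (k : ℕ) → .{{_ : NonZero k}} → ℕ → ℚ
grid k i = (+ i) / k

UpperSemicontinuous : (ℚ → ℚ) → Set
UpperSemicontinuous f =
  ∀ a → Dom a → ∀ ε → 0ℚ < ε → Σ ℚ λ δ → (0ℚ < δ) ×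
    (∀ x → Dom x → ∣ x - a ∣ < δ → f x < f a + ε)

InPiece : (k : ℕ) → .{{_ : NonZero k}} → ℕ → ℚ → Set
InPiece k i x = (grid k (i ∸ 1) < x) × (x < grid k i)

record InPtilde (k : ℕ) .{{_ : NonZero k}} (f : ℚ → ℚ) : Set where
  field
    inP        : InP f
    integral   : ∀ i → 1 ℕ.≤ i → i ℕ.≤ k →
                 Σ ℤ λ z → ℤtoℚ (+ k) * f (grid k i) ≡ ℤtoℚ z
    usc        : UpperSemicontinuous f
    pieceSlope : ∀ i → 1 ℕ.≤ i → i ℕ.≤ k →
                 Σ ℤ λ s → (s ℤ.≤ + 0) × Σ ℚ λ c →
                   ∀ x → InPiece k i x → f x ≡ c + ℤtoℚ s * x

record InSC (k : ℕ) .{{_ : NonZero k}} (f : ℚ → ℚ) : Set where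
  field
    inPtilde   : InPtilde k f
    constOrNeg : ∀ i → 1 ℕ.≤ i → i ℕ.≤ k →
                 Σ ℚ λ c →
                   (∀ x → InPiece k i x → f x ≡ c)
                   ⊎ (∀ x → InPiece k i x → f x ≡ c - x)

SameOn01 : (ℚ → ℚ) → (ℚ → ℚ) → Set
SameOn01 f g = ∀ x → Dom x → f x ≡ g x

SCHasCardinality : (k : ℕ) → .{{_ : NonZero k}} → ℕ → Set
SCHasCardinality k n =
  Σ (List (ℚ → ℚ)) λ L →
    (length L ≡ n) ×
    All (InSC k) L ×
    AllPairs (λ f g → ¬ SameOn01 f g) L ×
    (∀ f → InSC k f → Any (SameOn01 f) L)

{-# OPTIONS --safe #-}
module Submission where

-- A function f in SC_k is determined by its k pieces: on (j/k, (j+1)/k] it is either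
-- constant or of slope -1, and k f((j+1)/k) = a_j is a natural number; since f is
-- decreasing, upper semicontinuity makes it left continuous at the grid points, so the
-- piece is the pair (a_j, shape).  Let t_j be k times the right limit of f at j/k
-- (t_j = a_j for a constant piece, a_j + 1 for a slanted one).  Then f lies in SC_k iff
-- piece 0 is the constant 1, t_(j+1) ≤ a_j (monotonicity) and t_j + j > k for j ≥ 1
-- (the right limit at j/k exceeds 1 - j/k).  Sorting these sequences by the top of the
-- first remaining piece -- a constant piece of height t leaves the bound t for the rest,
-- a slanted one the bound t - 1 -- gives the recurrence of the lattice paths counted by
-- the Schröder numbers.

open import Defs
open import Data.Nat using (ℕ; NonZero; _∸_)
open import Data.Nat as ℕ using (zero; suc; z≤n; s≤s)
import Data.Nat.Properties as ℕ
open import Data.Integer as ℤ using (ℤ; -[1+_]; 1ℤ)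
import Data.Integer.Properties as ℤ
import Data.Integer.Tactic.RingSolver as ℤ-Solver
import Data.Rational as ℚ
open import Data.Rational using (ℚ; 0ℚ; 1ℚ; toℚᵘ; Positive)
open import Data.Rational.Properties
import Data.Rational.Unnormalised as ℚᵘ
import Data.Rational.Unnormalised.Properties as ℚᵘ
open import Data.Product using (Σ; ∃; _×_; _,_; proj₁; proj₂)
open import Data.Sum as Sum using (_⊎_; inj₁; inj₂)
open import Data.List using (List; []; _∷_; _++_; map; length; applyUpTo)
open import Data.List.Properties using (length-++; length-map; length-applyUpTo; ∷-injectiveʳ)
open import Data.List.Membership.Propositional using (_∈_)
open import Data.List.Membership.Propositional.Properties
  using (∈-map⁺; ∈-map⁻; ∈-++⁺ˡ; ∈-++⁺ʳ; ∈-applyUpTo⁺)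
import Data.List.Relation.Unary.Any as Any
open import Data.List.Relation.Unary.All as All using (All; []; _∷_)
import Data.List.Relation.Unary.All.Properties as All
open import Data.List.Relation.Unary.AllPairs using (AllPairs; []; _∷_)
import Data.List.Relation.Unary.AllPairs.Properties as AllPairs
open import Data.List.Relation.Unary.Unique.Propositional using (Unique)
import Data.List.Relation.Unary.Unique.Propositional.Properties as Unique
open import Data.List.Relation.Binary.Disjoint.Propositional using (Disjoint)
import Data.Empty.Irrelevant as Irrelevant
open import Level using (0ℓ)
open import Relation.Binary.PropositionalEquality
open import Relation.Nullary using (¬_; yes; no)
open import Relation.Nullary.Decidable using (dec⇒maybe)
open import Relation.Nullary.Negation using (contradiction)
open import Tactic.RingSolver using (solve-∀)
open import Tactic.RingSolver.Core.AlmostCommutativeRing using (AlmostCommutativeRing; fromCommutativeRing)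

-- Staircase codes and their enumeration

module Codes where
  open import Data.Nat using (_+_; _≤_; _<_)

  data Shape : Set where
    flat slant : Shape

  record Piece : Set where
    constructor _,_
    field
      bottom : ℕ
      shape  : Shape
  open Piece public

  top : Piece → ℕ
  top (a , flat)  = a
  top (a , slant) = suc a

  bottom≤top : ∀ p → bottom p ≤ top p
  bottom≤top (a , flat)  = ℕ.≤-refl
  bottom≤top (a , slant) = ℕ.n≤1+n a

  top≤1+bottom : ∀ p → top p ≤ suc (bottom p)
  top≤1+bottom (a , flat)  = ℕ.n≤1+n a
  top≤1+bottom (a , slant) = ℕ.≤-refl

  pieceAt : List Piece → ℕ → Piece
  pieceAt []       _       = 0 , flat
  pieceAt (p ∷ ps) zero    = p
  pieceAt (p ∷ ps) (suc j) = pieceAt ps j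

  pieceAt-applyUpTo : ∀ (g : ℕ → Piece) {m j} → j < m → pieceAt (applyUpTo g m) j ≡ g j
  pieceAt-applyUpTo g {suc m} {zero}  _         = refl
  pieceAt-applyUpTo g {suc m} {suc j} (s≤s j<m) = pieceAt-applyUpTo (λ i → g (suc i)) j<m

  pieceAt-ext : ∀ {ps qs} → length ps ≡ length qs →
                (∀ j → j < length ps → pieceAt ps j ≡ pieceAt qs j) → ps ≡ qs
  pieceAt-ext {[]}     {[]}     _     _    = refl
  pieceAt-ext {p ∷ ps} {q ∷ qs} |ps|≡ same =
    cong₂ _∷_ (same 0 (s≤s z≤n)) (pieceAt-ext (ℕ.suc-injective |ps|≡) (λ j j< → same (suc j) (s≤s j<)))

  -- Admissible m a ps: ps are the last m of the k pieces of a staircase, and a bounds the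
  -- top of the first of them.  In cons, p is followed by m pieces, so it starts at j/k with
  -- j = k - 1 - m, and 2 + m ≤ top p says that the right limit at j/k exceeds 1 - j/k.
  data Admissible : ℕ → ℕ → List Piece → Set where
    []   : ∀ {a} → Admissible 0 a []
    cons : ∀ {m a p ps} → top p ≤ a → 2 + m ≤ top p → Admissible m (bottom p) ps →
           Admissible (suc m) a (p ∷ ps)

  Admissible-weaken : ∀ {m a a′ ps} → a ≤ a′ → Admissible m a ps → Admissible m a′ ps
  Admissible-weaken a≤a′ []                      = []
  Admissible-weaken a≤a′ (cons top≤a lower rest) = cons (ℕ.≤-trans top≤a a≤a′) lower rest

  Admissible-length : ∀ {m a ps} → Admissible m a ps → length ps ≡ m
  Admissible-length []              = refl
  Admissible-length (cons _ _ rest) = cong suc (Admissible-length rest)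

  Admissible-top≤ : ∀ {m a ps j} → Admissible m a ps → j < m → top (pieceAt ps j) ≤ a
  Admissible-top≤ {j = zero}  (cons top≤a _ _) _ = top≤a
  Admissible-top≤ {j = suc j} (cons {p = p} top≤a _ rest) (s≤s j<m) =
    ℕ.≤-trans (Admissible-top≤ rest j<m) (ℕ.≤-trans (bottom≤top p) top≤a)

  Admissible-descending : ∀ {m a ps i j} → Admissible m a ps → i < j → j < m →
                          top (pieceAt ps j) ≤ bottom (pieceAt ps i)
  Admissible-descending {i = zero}  {suc j} (cons _ _ rest) _         (s≤s j<m) = Admissible-top≤ rest j<m
  Admissible-descending {i = suc i} {suc j} (cons _ _ rest) (s≤s i<j) (s≤s j<m) =
    Admissible-descending rest i<j j<m

  Admissible-above : ∀ {m a ps j} → Admissible m a ps → j < m → suc m ≤ j + top (pieceAt ps j)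
  Admissible-above {j = zero}  (cons _ lower _) _         = lower
  Admissible-above {j = suc j} (cons _ _ rest)  (s≤s j<m) = s≤s (Admissible-above rest j<m)

  Admissible-last : ∀ {m a ps} → Admissible (suc m) a ps → 0 < bottom (pieceAt ps m)
  Admissible-last {zero}  (cons {p = p} _ lower _) = ℕ.≤-pred (ℕ.≤-trans lower (top≤1+bottom p))
  Admissible-last {suc m} (cons _ _ rest)          = Admissible-last rest

  applyUpTo-admissible : ∀ m {a} (g : ℕ → Piece) → (0 < m → top (g 0) ≤ a) →
                         (∀ j → suc j < m → top (g (suc j)) ≤ bottom (g j)) →
                         (∀ j → j < m → suc m ≤ j + top (g j)) →
                         Admissible m a (applyUpTo g m)
  applyUpTo-admissible zero    g _     _          _     = []
  applyUpTo-admissible (suc m) g first descending above =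
    cons (first (s≤s z≤n)) (above 0 (s≤s z≤n))
      (applyUpTo-admissible m (λ j → g (suc j)) (λ 0<m → descending 0 (s≤s 0<m))
        (λ j j<m → descending (suc j) (s≤s j<m)) (λ j j<m → ℕ.≤-pred (above (suc j) (s≤s j<m))))

  -- The bound 1 + e + m of admissibles m e exceeds the least useful one, 1 + m, by e.
  mutual
    admissibles : ℕ → ℕ → List (List Piece)
    admissibles zero    e       = [] ∷ []
    admissibles (suc m) zero    = admissiblesWithTop m zero
    admissibles (suc m) (suc e) = admissibles (suc m) e ++ admissiblesWithTop m (suc e)

    admissiblesWithTop : ℕ → ℕ → List (List Piece)
    admissiblesWithTop m e =
      map ((2 + e + m , flat) ∷_) (admissibles m (suc e)) ++
      map ((suc (e + m) , slant) ∷_) (admissibles m e)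

  paths-zero : ∀ a → paths a 0 ≡ 1
  paths-zero zero    = refl
  paths-zero (suc a) = paths-zero a

  paths-above-diagonal : ∀ {a b} → a < b → paths a b ≡ 0
  paths-above-diagonal {zero}  {suc b} _ = refl
  paths-above-diagonal {suc a} {suc b} a<b with suc b ℕ.≤? suc a
  ... | yes b≤a = contradiction b≤a (ℕ.<⇒≱ a<b)
  ... | no  _   = refl

  paths-suc-suc : ∀ {a b} → b ≤ a →
                  paths (suc a) (suc b) ≡ paths a (suc b) + paths (suc a) b + paths a b
  paths-suc-suc {a} {b} b≤a with suc b ℕ.≤? suc a
  ... | yes _   = refl
  ... | no  b≰a = contradiction (s≤s b≤a) b≰a

  length-admissiblesWithTop : ∀ m e →
    length (admissiblesWithTop m e) ≡ length (admissibles m (suc e)) + length (admissibles m e)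
  length-admissiblesWithTop m e = begin
    length (map _ (admissibles m (suc e)) ++ map _ (admissibles m e))
      ≡⟨ length-++ (map _ (admissibles m (suc e))) ⟩
    length (map _ (admissibles m (suc e))) + length (map _ (admissibles m e))
      ≡⟨ cong₂ _+_ (length-map _ (admissibles m (suc e))) (length-map _ (admissibles m e)) ⟩
    length (admissibles m (suc e)) + length (admissibles m e)
      ∎
    where open ≡-Reasoning

  length-admissibles : ∀ m e → length (admissibles m e) ≡ paths (e + m) m
  length-admissibles zero e = begin
    1                ≡⟨ paths-zero e ⟨
    paths e 0        ≡⟨ cong (λ a → paths a 0) (ℕ.+-identityʳ e) ⟨
    paths (e + 0) 0  ∎
    where open ≡-Reasoning
  length-admissibles (suc m) zero = begin
    length (admissiblesWithTop m 0)                      ≡⟨ length-admissiblesWithTop m 0 ⟩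
    length (admissibles m 1) + length (admissibles m 0)
      ≡⟨ cong₂ _+_ (length-admissibles m 1) (length-admissibles m 0) ⟩
    paths (suc m) m + paths m m
      ≡⟨ cong (_+ (paths (suc m) m + paths m m)) (paths-above-diagonal (ℕ.n<1+n m)) ⟨
    paths m (suc m) + (paths (suc m) m + paths m m)      ≡⟨ ℕ.+-assoc (paths m (suc m)) _ _ ⟨
    paths m (suc m) + paths (suc m) m + paths m m        ≡⟨ paths-suc-suc {m} ℕ.≤-refl ⟨
    paths (suc m) (suc m)                                ∎
    where open ≡-Reasoning
  length-admissibles (suc m) (suc e) = begin
    length (admissibles (suc m) e ++ admissiblesWithTop m (suc e))
      ≡⟨ length-++ (admissibles (suc m) e) ⟩
    length (admissibles (suc m) e) + length (admissiblesWithTop m (suc e))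
      ≡⟨ cong₂ _+_ (length-admissibles (suc m) e) (length-admissiblesWithTop m (suc e)) ⟩
    paths a (suc m) + (length (admissibles m (2 + e)) + length (admissibles m (suc e)))
      ≡⟨ cong (paths a (suc m) +_) (cong₂ _+_ (length-admissibles m (2 + e)) (length-admissibles m (suc e))) ⟩
    paths a (suc m) + (paths (2 + e + m) m + paths (suc e + m) m)
      ≡⟨ cong (λ b → paths a (suc m) + (paths (suc b) m + paths b m)) (ℕ.+-suc e m) ⟨
    paths a (suc m) + (paths (suc a) m + paths a m)
      ≡⟨ ℕ.+-assoc (paths a (suc m)) _ _ ⟨
    paths a (suc m) + paths (suc a) m + paths a m
      ≡⟨ paths-suc-suc (ℕ.≤-trans (ℕ.n≤1+n m) (ℕ.m≤n+m (suc m) e)) ⟨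
    paths (suc a) (suc m)
      ∎
    where
    open ≡-Reasoning
    a = e + suc m

  admissibles-sound : ∀ m e → All (Admissible m (suc (e + m))) (admissibles m e)

  admissiblesWithTop-sound : ∀ m e {a} → 2 + e + m ≤ a → All (Admissible (suc m) a) (admissiblesWithTop m e)
  admissiblesWithTop-sound m e top≤a = All.++⁺
    (All.map⁺ (All.map (cons top≤a (ℕ.+-monoʳ-≤ 2 (ℕ.m≤n+m m e))) (admissibles-sound m (suc e))))
    (All.map⁺ (All.map (cons top≤a (ℕ.+-monoʳ-≤ 2 (ℕ.m≤n+m m e))) (admissibles-sound m e)))

  admissibles-sound zero    e       = [] ∷ []
  admissibles-sound (suc m) zero    = admissiblesWithTop-sound m 0 ℕ.≤-refl
  admissibles-sound (suc m) (suc e) = All.++⁺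
    (All.map (Admissible-weaken (ℕ.n≤1+n _)) (admissibles-sound (suc m) e))
    (admissiblesWithTop-sound m (suc e) (ℕ.≤-reflexive (cong (2 +_) (sym (ℕ.+-suc e m)))))

  AdmissiblesComplete : ℕ → Set
  AdmissiblesComplete m = ∀ e {ps} → Admissible m (suc (e + m)) ps → ps ∈ admissibles m e

  admissiblesWithTop-complete : ∀ {m} → AdmissiblesComplete m → ∀ e {p ps} → top p ≡ 2 + e + m →
                                Admissible m (bottom p) ps → p ∷ ps ∈ admissiblesWithTop m e
  admissiblesWithTop-complete complete e {_ , flat} refl rest =
    ∈-++⁺ˡ (∈-map⁺ _ (complete (suc e) rest))
  admissiblesWithTop-complete {m} complete e {_ , slant} refl rest =
    ∈-++⁺ʳ (map _ (admissibles m (suc e))) (∈-map⁺ _ (complete e rest))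

  admissibles-complete-suc : ∀ {m} → AdmissiblesComplete m → AdmissiblesComplete (suc m)
  admissibles-complete-suc complete zero (cons top≤ lower rest) =
    admissiblesWithTop-complete complete 0 (ℕ.≤-antisym top≤ lower) rest
  admissibles-complete-suc {m} complete (suc e) {p ∷ ps} (cons top≤ lower rest)
    with top p ℕ.≟ 2 + suc e + m
  ... | yes top≡ = ∈-++⁺ʳ (admissibles (suc m) e) (admissiblesWithTop-complete complete (suc e) top≡ rest)
  ... | no  top≢ = ∈-++⁺ˡ (admissibles-complete-suc complete e (cons top≤′ lower rest))
    where
    top≤′ : top p ≤ suc (e + suc m)
    top≤′ = subst (top p ≤_) (cong suc (sym (ℕ.+-suc e m)))
      (ℕ.≤-pred (ℕ.≤∧≢⇒< (subst (top p ≤_) (cong (2 +_) (ℕ.+-suc e m)) top≤) top≢))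

  admissibles-complete : ∀ m → AdmissiblesComplete m
  admissibles-complete zero    e [] = Any.here refl
  admissibles-complete (suc m)      = admissibles-complete-suc (admissibles-complete m)

  headTop : List Piece → ℕ
  headTop []      = 0
  headTop (p ∷ _) = top p

  headTop-admissible : ∀ {m a ps} → Admissible (suc m) a ps → headTop ps ≤ a
  headTop-admissible (cons top≤a _ _) = top≤a

  headTop-admissiblesWithTop : ∀ m e → All (λ ps → headTop ps ≡ 2 + e + m) (admissiblesWithTop m e)
  headTop-admissiblesWithTop m e = All.++⁺
    (All.map⁺ {f = (2 + e + m , flat) ∷_} (All.tabulate {xs = admissibles m (suc e)} (λ _ → refl)))
    (All.map⁺ {f = (suc (e + m) , slant) ∷_} (All.tabulate {xs = admissibles m e} (λ _ → refl)))

  flat-slant-disjoint : ∀ {a b} (xss yss : List (List Piece)) →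
                        Disjoint (map ((a , flat) ∷_) xss) (map ((b , slant) ∷_) yss)
  flat-slant-disjoint {a} {b} xss yss (v∈xss , v∈yss)
    with ∈-map⁻ ((a , flat) ∷_) v∈xss | ∈-map⁻ ((b , slant) ∷_) v∈yss
  ... | _ , _ , refl | _ , _ , ()

  admissibles-unique : ∀ m e → Unique (admissibles m e)

  admissiblesWithTop-unique : ∀ m e → Unique (admissiblesWithTop m e)
  admissiblesWithTop-unique m e = Unique.++⁺
    (Unique.map⁺ ∷-injectiveʳ (admissibles-unique m (suc e)))
    (Unique.map⁺ ∷-injectiveʳ (admissibles-unique m e))
    (flat-slant-disjoint (admissibles m (suc e)) (admissibles m e))

  admissibles-unique zero    e       = [] ∷ []
  admissibles-unique (suc m) zero    = admissiblesWithTop-unique m 0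
  admissibles-unique (suc m) (suc e) = Unique.++⁺
    (admissibles-unique (suc m) e) (admissiblesWithTop-unique m (suc e)) disjoint
    where
    too-high : ¬ 2 + suc e + m ≤ suc (e + suc m)
    too-high rewrite ℕ.+-suc e m = ℕ.1+n≰n
    disjoint : Disjoint (admissibles (suc m) e) (admissiblesWithTop m (suc e))
    disjoint (v∈old , v∈new) = too-high (subst (_≤ suc (e + suc m))
      (All.lookup (headTop-admissiblesWithTop m (suc e)) v∈new)
      (headTop-admissible (All.lookup (admissibles-sound (suc m) e) v∈old)))

open Codes

-- Rational arithmetic

-- Opened only here: inside Codes these operators would clash with those of ℕ.
open import Data.Integer using (+_)
open import Data.Rational using (_+_; _*_; _-_; -_; _≤_; _<_; _⊓_; _⊔_; ∣_∣)

ℚ-ring : AlmostCommutativeRing 0ℓ 0ℓ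
ℚ-ring = fromCommutativeRing +-*-commutativeRing (λ x → dec⇒maybe (0ℚ ≟ x))

p+q-q≡p : ∀ p q → p + q - q ≡ p
p+q-q≡p = solve-∀ ℚ-ring

p+q-p≡q : ∀ p q → p + q - p ≡ q
p+q-p≡q = solve-∀ ℚ-ring

p+[q-p]≡q : ∀ p q → p + (q - p) ≡ q
p+[q-p]≡q = solve-∀ ℚ-ring

p-q+q≡p : ∀ p q → p - q + q ≡ p
p-q+q≡p = solve-∀ ℚ-ring

p-q+[q-r]≡p-r : ∀ p q r → p - q + (q - r) ≡ p - r
p-q+[q-r]≡p-r = solve-∀ ℚ-ring

[p-q]-[p-r]≡-[q-r] : ∀ p q r → (p - q) - (p - r) ≡ - (q - r)
[p-q]-[p-r]≡-[q-r] = solve-∀ ℚ-ring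

<⇒≱ : ∀ {p q} → p < q → ¬ q ≤ p
<⇒≱ p<q q≤p = <-irrefl refl (<-≤-trans p<q q≤p)

p≤p+q : ∀ {p q} → 0ℚ ≤ q → p ≤ p + q
p≤p+q {p} {q} 0≤q = subst (_≤ p + q) (+-identityʳ p) (+-monoʳ-≤ p 0≤q)

p<p+q : ∀ {p q} → 0ℚ < q → p < p + q
p<p+q {p} {q} 0<q = subst (_< p + q) (+-identityʳ p) (+-monoʳ-< p 0<q)

p-q<p : ∀ {p q} → 0ℚ < q → p - q < p
p-q<p {p} {q} 0<q = subst (p - q <_) (+-identityʳ p) (+-monoʳ-< p (neg-antimono-< 0<q))

p≤q⇒0≤q-p : ∀ {p q} → p ≤ q → 0ℚ ≤ q - p
p≤q⇒0≤q-p {p} {q} p≤q = subst (_≤ q - p) (+-inverseʳ p) (+-monoˡ-≤ (- p) p≤q)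

p<q⇒0<q-p : ∀ {p q} → p < q → 0ℚ < q - p
p<q⇒0<q-p {p} {q} p<q = subst (_< q - p) (+-inverseʳ p) (+-monoˡ-< (- p) p<q)

p<q+r⇒p-q<r : ∀ {p q r} → p < q + r → p - q < r
p<q+r⇒p-q<r {p} {q} {r} p<q+r = subst (p - q <_) (p+q-p≡q q r) (+-monoˡ-< (- q) p<q+r)

p<q+r⇒p-r<q : ∀ {p q r} → p < q + r → p - r < q
p<q+r⇒p-r<q {p} {q} {r} p<q+r = p<q+r⇒p-q<r (subst (p <_) (+-comm q r) p<q+r)

p-q<r⇒p<q+r : ∀ {p q r} → p - q < r → p < q + r
p-q<r⇒p<q+r {p} {q} {r} p-q<r =
  subst (_< q + r) (trans (+-comm q (p - q)) (p-q+q≡p p q)) (+-monoʳ-< q p-q<r)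

p-q<p-r⇒r<q : ∀ {p q r} → p - q < p - r → r < q
p-q<p-r⇒r<q {p} {q} {r} p-q<p-r =
  subst₂ _<_ (shiftʳ p q r) (shiftˡ p q r) (+-monoˡ-< (q + r - p) p-q<p-r)
  where
  shiftʳ : ∀ p q r → p - q + (q + r - p) ≡ r
  shiftʳ = solve-∀ ℚ-ring
  shiftˡ : ∀ p q r → p - r + (q + r - p) ≡ q
  shiftˡ = solve-∀ ℚ-ring

⊓-glb-< : ∀ {p q r} → p < q → p < r → p < q ⊓ r
⊓-glb-< {p} {q} {r} p<q p<r with ⊓-sel q r
... | inj₁ q⊓r≡q = subst (p <_) (sym q⊓r≡q) p<q
... | inj₂ q⊓r≡r = subst (p <_) (sym q⊓r≡r) p<r

⊔-lub-< : ∀ {p q r} → p < r → q < r → p ⊔ q < r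
⊔-lub-< {p} {q} {r} p<r q<r with ⊔-sel p q
... | inj₁ p⊔q≡p = subst (_< r) (sym p⊔q≡p) p<r
... | inj₂ p⊔q≡q = subst (_< r) (sym p⊔q≡q) q<r

p≤∣p∣ : ∀ p → p ≤ ∣ p ∣
p≤∣p∣ p with 0ℚ ≤? p
... | yes 0≤p = ≤-reflexive (sym (0≤p⇒∣p∣≡p 0≤p))
... | no  0≰p = ≤-trans (<⇒≤ (≰⇒> 0≰p)) (0≤∣p∣ p)

q-p≤∣p-q∣ : ∀ p q → q - p ≤ ∣ p - q ∣
q-p≤∣p-q∣ p q = subst₂ _≤_ (-[p-q]≡q-p p q) (∣-p∣≡∣p∣ (p - q)) (p≤∣p∣ (- (p - q)))
  where
  -[p-q]≡q-p : ∀ p q → - (p - q) ≡ q - p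
  -[p-q]≡q-p = solve-∀ ℚ-ring

∣p-q∣≡p-q : ∀ {p q} → q ≤ p → ∣ p - q ∣ ≡ p - q
∣p-q∣≡p-q q≤p = 0≤p⇒∣p∣≡p (p≤q⇒0≤q-p q≤p)

∣p-q∣≡q-p : ∀ {p q} → p ≤ q → ∣ p - q ∣ ≡ q - p
∣p-q∣≡q-p {p} {q} p≤q =
  trans (trans (cong ∣_∣ (p-q≡-[q-p] p q)) (∣-p∣≡∣p∣ (q - p))) (∣p-q∣≡p-q p≤q)
  where
  p-q≡-[q-p] : ∀ p q → p - q ≡ - (q - p)
  p-q≡-[q-p] = solve-∀ ℚ-ring

*-cancelˡ-pos : ∀ r .{{_ : Positive r}} {p q} → r * p ≡ r * q → p ≡ q
*-cancelˡ-pos r rp≡rq =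
  ≤-antisym (*-cancelˡ-≤-pos r (≤-reflexive rp≡rq)) (*-cancelˡ-≤-pos r (≤-reflexive (sym rp≡rq)))

∃-close-below : ∀ {l r η} → l < r → 0ℚ < η → ∃ λ x → l < x × x < r × r - x < η
∃-close-below {l} {r} {η} l<r 0<η =
  let x , l⊔[r-η]<x , x<r = <-dense (⊔-lub-< l<r (p-q<p {r} 0<η))
  in x , ≤-<-trans (p≤p⊔q l (r - η)) l⊔[r-η]<x , x<r ,
     p<q+r⇒p-r<q {r} {η} (p-q<r⇒p<q+r (≤-<-trans (p≤q⊔p l (r - η)) l⊔[r-η]<x))

SlopeIn[-1,0] : (ℚ → ℚ) → Set
SlopeIn[-1,0] g = ∀ {x y} → x ≤ y → g y ≤ g x × g x ≤ g y + (y - x)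

-- Since f is decreasing, upper semicontinuity makes it left continuous.
agree-at-right-end : ∀ {f g : ℚ → ℚ} {l r} → Decreasing f → UpperSemicontinuous f → SlopeIn[-1,0] g →
                     Dom l → Dom r → l < r → (∀ x → l < x → x < r → f x ≡ g x) → f r ≡ g r
agree-at-right-end {f} {g} {l} {r} decreasing usc g-slope (0≤l , _) Dom-r@(_ , r≤1) l<r agree =
  ≤-antisym (≮⇒≥ g≮f) (≮⇒≥ f≮g)
  where
  Dom-inside : ∀ {y} → l < y → y < r → Dom y
  Dom-inside l<y y<r = ≤-trans 0≤l (<⇒≤ l<y) , ≤-trans (<⇒≤ y<r) r≤1

  g≮f : ¬ g r < f r
  g≮f g<f =
    let y , l<y , y<r , r-y< = ∃-close-below l<r (p<q⇒0<q-p g<f)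
    in <-irrefl refl (begin-strict
      f r                ≤⟨ decreasing y r (Dom-inside l<y y<r) Dom-r (<⇒≤ y<r) ⟩
      f y                ≡⟨ agree y l<y y<r ⟩
      g y                ≤⟨ proj₂ (g-slope (<⇒≤ y<r)) ⟩
      g r + (r - y)      <⟨ +-monoʳ-< (g r) r-y< ⟩
      g r + (f r - g r)  ≡⟨ p+[q-p]≡q (g r) (f r) ⟩
      f r                ∎)
    where open ≤-Reasoning

  f≮g : ¬ f r < g r
  f≮g f<g =
    let δ , 0<δ , close = usc r Dom-r (g r - f r) (p<q⇒0<q-p f<g)
        y , l<y , y<r , r-y<δ = ∃-close-below l<r 0<δ
        ∣y-r∣<δ = subst (_< δ) (sym (∣p-q∣≡q-p (<⇒≤ y<r))) r-y<δ
    in <-irrefl refl (begin-strict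
      g r                ≤⟨ proj₁ (g-slope (<⇒≤ y<r)) ⟩
      g y                ≡⟨ agree y l<y y<r ⟨
      f y                <⟨ close y (Dom-inside l<y y<r) ∣y-r∣<δ ⟩
      f r + (g r - f r)  ≡⟨ p+[q-p]≡q (f r) (g r) ⟩
      g r                ∎)
    where open ≤-Reasoning

RightLimit-≤ : ∀ {f a b L M} → RightLimit f a L → a < b → b ≤ 1ℚ →
               (∀ x → a < x → x < b → f x ≤ M) → L ≤ M
RightLimit-≤ {f} {a} {b} {L} {M} limit a<b b≤1 bounded = ≮⇒≥ M≮L
  where
  M≮L : ¬ M < L
  M≮L M<L =
    let δ , 0<δ , close = limit (L - M) (p<q⇒0<q-p M<L)
        x , a<x , x<min = <-dense (⊓-glb-< (p<p+q {a} 0<δ) a<b)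
        x<b = <-≤-trans x<min (p⊓q≤q (a + δ) b)
        ∣fx-L∣<L-M = close x a<x (<-≤-trans x<min (p⊓q≤p (a + δ) b)) (≤-trans (<⇒≤ x<b) b≤1)
    in <⇒≱ (p-q<p-r⇒r<q {L} (≤-<-trans (q-p≤∣p-q∣ (f x) L) ∣fx-L∣<L-M)) (bounded x a<x x<b)

-- The scale 1/k

module Scale (n : ℕ) where

  k : ℕ
  k = suc n

  -- Opaque because unfolding grid k a exposes the gcd normalisation of ℚ, which makes
  -- unification problems involving a /k very slow.
  infix 8 _/k
  opaque
    _/k : ℕ → ℚ
    a /k = grid k a

  opaque
    unfolding _/k

    grid≡/k : ∀ a → grid k a ≡ a /k
    grid≡/k a = refl

    toℚᵘ-/k : ∀ a → toℚᵘ (a /k) ℚᵘ.≃ ℚᵘ.mkℚᵘ (+ a) n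
    toℚᵘ-/k a = toℚᵘ-fromℚᵘ (ℚᵘ.mkℚᵘ (+ a) n)

    0/k≡0 : 0 /k ≡ 0ℚ
    0/k≡0 = 0/n≡0 k

    0≤/k : ∀ a → 0ℚ ≤ a /k
    0≤/k a = nonNegative⁻¹ (a /k) {{normalize-nonNeg a k}}

    0</k : ∀ {a} → 0 ℕ.< a → 0ℚ < a /k
    0</k {suc a} _ = positive⁻¹ (suc a /k) {{normalize-pos (suc a) k}}

  toℚᵘ-ℤtoℚ : ∀ a → toℚᵘ (ℤtoℚ (+ a)) ℚᵘ.≃ ℚᵘ.mkℚᵘ (+ a) 0
  toℚᵘ-ℤtoℚ a = toℚᵘ-fromℚᵘ (ℚᵘ.mkℚᵘ (+ a) 0)

  /k-+ : ∀ a b → (a ℕ.+ b) /k ≡ a /k + b /k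
  /k-+ a b = toℚᵘ-injective (begin
    toℚᵘ ((a ℕ.+ b) /k)                    ≈⟨ toℚᵘ-/k (a ℕ.+ b) ⟩
    ℚᵘ.mkℚᵘ (+ (a ℕ.+ b)) n                ≈⟨ ℚᵘ.*≡* eq ⟩
    ℚᵘ.mkℚᵘ (+ a) n ℚᵘ.+ ℚᵘ.mkℚᵘ (+ b) n  ≈⟨ ℚᵘ.+-cong (toℚᵘ-/k a) (toℚᵘ-/k b) ⟨
    toℚᵘ (a /k) ℚᵘ.+ toℚᵘ (b /k)          ≈⟨ toℚᵘ-homo-+ (a /k) (b /k) ⟨
    toℚᵘ (a /k + b /k)                    ∎)
    where
    open ℚᵘ.≃-Reasoning
    distrib : ∀ (a b k : ℤ) → (a ℤ.+ b) ℤ.* (k ℤ.* k) ≡ (a ℤ.* k ℤ.+ b ℤ.* k) ℤ.* k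
    distrib = ℤ-Solver.solve-∀
    eq : + (a ℕ.+ b) ℤ.* + (k ℕ.* k) ≡ (+ a ℤ.* + k ℤ.+ + b ℤ.* + k) ℤ.* + k
    eq rewrite ℤ.pos-+ a b | ℤ.pos-* k k = distrib (+ a) (+ b) (+ k)

  k/k≡1 : k /k ≡ 1ℚ
  k/k≡1 = toℚᵘ-injective (ℚᵘ.≃-trans (toℚᵘ-/k k) (ℚᵘ.*≡* (ℤ.*-comm (+ k) (+ 1))))

  k*[a/k]≡a : ∀ a → ℤtoℚ (+ k) * a /k ≡ ℤtoℚ (+ a)
  k*[a/k]≡a a = toℚᵘ-injective (begin
    toℚᵘ (ℤtoℚ (+ k) * a /k)                ≈⟨ toℚᵘ-homo-* (ℤtoℚ (+ k)) (a /k) ⟩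
    toℚᵘ (ℤtoℚ (+ k)) ℚᵘ.* toℚᵘ (a /k)
      ≈⟨ ℚᵘ.*-cong (toℚᵘ-ℤtoℚ k) (toℚᵘ-/k a) ⟩
    ℚᵘ.mkℚᵘ (+ k) 0 ℚᵘ.* ℚᵘ.mkℚᵘ (+ a) n    ≈⟨ ℚᵘ.*≡* eq ⟩
    ℚᵘ.mkℚᵘ (+ a) 0                        ≈⟨ toℚᵘ-ℤtoℚ a ⟨
    toℚᵘ (ℤtoℚ (+ a))                      ∎)
    where
    open ℚᵘ.≃-Reasoning
    comm : ∀ (a k : ℤ) → (k ℤ.* a) ℤ.* 1ℤ ≡ a ℤ.* k
    comm = ℤ-Solver.solve-∀
    eq : (+ k ℤ.* + a) ℤ.* + 1 ≡ + a ℤ.* + (1 ℕ.* k)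
    eq rewrite ℕ.*-identityˡ k = comm (+ a) (+ k)

  /k-mono-≤ : ∀ {a b} → a ℕ.≤ b → a /k ≤ b /k
  /k-mono-≤ {a} {b} a≤b = begin
    a /k                ≤⟨ p≤p+q (0≤/k (b ∸ a)) ⟩
    a /k + (b ∸ a) /k   ≡⟨ /k-+ a (b ∸ a) ⟨
    (a ℕ.+ (b ∸ a)) /k  ≡⟨ cong _/k (ℕ.m+[n∸m]≡n a≤b) ⟩
    b /k                ∎
    where open ≤-Reasoning

  /k-mono-< : ∀ {a b} → a ℕ.< b → a /k < b /k
  /k-mono-< {a} {b} a<b = begin-strict
    a /k          ≡⟨ +-identityʳ (a /k) ⟨
    a /k + 0ℚ     <⟨ +-monoʳ-< (a /k) (0</k {1} (s≤s z≤n)) ⟩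
    a /k + 1 /k   ≡⟨ /k-+ a 1 ⟨
    (a ℕ.+ 1) /k  ≡⟨ cong _/k (ℕ.+-comm a 1) ⟩
    suc a /k      ≤⟨ /k-mono-≤ a<b ⟩
    b /k          ∎
    where open ≤-Reasoning

  /k-cancel-≤ : ∀ {a b} → a /k ≤ b /k → a ℕ.≤ b
  /k-cancel-≤ a/k≤b/k = ℕ.≮⇒≥ (λ b<a → <⇒≱ (/k-mono-< b<a) a/k≤b/k)

  /k-cancel-< : ∀ {a b} → a /k < b /k → a ℕ.< b
  /k-cancel-< a/k<b/k = ℕ.≰⇒> (λ b≤a → <⇒≱ a/k<b/k (/k-mono-≤ b≤a))

  /k-injective : ∀ {a b} → a /k ≡ b /k → a ≡ b
  /k-injective a/k≡b/k =
    ℕ.≤-antisym (/k-cancel-≤ (≤-reflexive a/k≡b/k)) (/k-cancel-≤ (≤-reflexive (sym a/k≡b/k)))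

  Dom-/k : ∀ {a} → a ℕ.≤ k → Dom (a /k)
  Dom-/k {a} a≤k = 0≤/k a , subst (a /k ≤_) k/k≡1 (/k-mono-≤ a≤k)

  Dom-between : ∀ {x a b} → a ℕ.≤ k → b ℕ.≤ k → a /k < x → x < b /k → Dom x
  Dom-between a≤k b≤k a/k<x x<b/k =
    ≤-trans (proj₁ (Dom-/k a≤k)) (<⇒≤ a/k<x) , ≤-trans (<⇒≤ x<b/k) (proj₂ (Dom-/k b≤k))

  k*q≡z⇒q≡∣z∣/k : ∀ {q z} → 0ℚ ≤ q → ℤtoℚ (+ k) * q ≡ ℤtoℚ z → q ≡ ℤ.∣ z ∣ /k
  k*q≡z⇒q≡∣z∣/k {q} {+ a} _ kq≡a =
    *-cancelˡ-pos (ℤtoℚ (+ k)) {{normalize-pos k 1}} (trans kq≡a (sym (k*[a/k]≡a a)))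
  k*q≡z⇒q≡∣z∣/k {q} { -[1+ m ]} 0≤q kq≡z = contradiction (subst (0ℚ ≤_) kq≡z 0≤kq) (<⇒≱ z<0)
    where
    0≤kq : 0ℚ ≤ ℤtoℚ (+ k) * q
    0≤kq = subst (_≤ ℤtoℚ (+ k) * q) (*-zeroʳ (ℤtoℚ (+ k)))
             (*-monoˡ-≤-nonNeg (ℤtoℚ (+ k)) {{normalize-nonNeg k 1}} 0≤q)
    z<0 : ℤtoℚ -[1+ m ] < 0ℚ
    z<0 = negative⁻¹ (ℤtoℚ -[1+ m ]) {{neg-pos {ℚ.normalize (suc m) 1} (normalize-pos (suc m) 1)}}

-- The staircase function of a code

module Staircase (n : ℕ) where
  open Scale n

  -- Piece number j lives on (j/k, (j+1)/k]; bottom p is k times its value at (j+1)/k.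
  value : ℕ → Piece → ℚ → ℚ
  value j (a , flat)  x = a /k
  value j (a , slant) x = (a ℕ.+ suc j) /k - x

  value-right : ∀ j p → value j p (suc j /k) ≡ bottom p /k
  value-right j (a , flat)  = refl
  value-right j (a , slant) = trans (cong (_- suc j /k) (/k-+ a (suc j))) (p+q-q≡p (a /k) (suc j /k))

  value-left : ∀ j p → value j p (j /k) ≡ top p /k
  value-left j (a , flat)  = refl
  value-left j (a , slant) = begin
    (a ℕ.+ suc j) /k - j /k  ≡⟨ cong (λ b → b /k - j /k) (ℕ.+-suc a j) ⟩
    (suc a ℕ.+ j) /k - j /k  ≡⟨ cong (_- j /k) (/k-+ (suc a) j) ⟩
    suc a /k + j /k - j /k   ≡⟨ p+q-q≡p (suc a /k) (j /k) ⟩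
    suc a /k                 ∎
    where open ≡-Reasoning

  value-antitone : ∀ j p {x y} → x ≤ y → value j p y ≤ value j p x
  value-antitone j (a , flat)  _   = ≤-refl
  value-antitone j (a , slant) x≤y = +-monoʳ-≤ ((a ℕ.+ suc j) /k) (neg-antimono-≤ x≤y)

  value-slant-strict : ∀ j a {x y} → x < y → value j (a , slant) y < value j (a , slant) x
  value-slant-strict j a x<y = +-monoʳ-< ((a ℕ.+ suc j) /k) (neg-antimono-< x<y)

  bottom≤value : ∀ j p {x} → x ≤ suc j /k → bottom p /k ≤ value j p x
  bottom≤value j p {x} x≤ = subst (_≤ value j p x) (value-right j p) (value-antitone j p x≤)

  bottom<value-slant : ∀ j a {x} → x < suc j /k → a /k < value j (a , slant) x
  bottom<value-slant j a {x} x< =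
    subst (_< value j (a , slant) x) (value-right j (a , slant)) (value-slant-strict j a x<)

  value≤top : ∀ j p {x} → j /k ≤ x → value j p x ≤ top p /k
  value≤top j p {x} ≤x = subst (value j p x ≤_) (value-left j p) (value-antitone j p ≤x)

  value-1-Lipschitz : ∀ j p x y → ∣ value j p x - value j p y ∣ ≤ ∣ x - y ∣
  value-1-Lipschitz j (a , flat) x y =
    subst (_≤ ∣ x - y ∣) (cong ∣_∣ (sym (+-inverseʳ (a /k)))) (0≤∣p∣ (x - y))
  value-1-Lipschitz j (a , slant) x y =
    ≤-reflexive (trans (cong ∣_∣ ([p-q]-[p-r]≡-[q-r] ((a ℕ.+ suc j) /k) x y)) (∣-p∣≡∣p∣ (x - y)))

  value-above-diagonal : ∀ j p {x} → j /k ≤ x → (j ℕ.+ top p) /k - x ≤ value j p x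
  value-above-diagonal j (a , flat) {x} j/k≤x = begin
    (j ℕ.+ a) /k - x     ≤⟨ +-monoʳ-≤ ((j ℕ.+ a) /k) (neg-antimono-≤ j/k≤x) ⟩
    (j ℕ.+ a) /k - j /k  ≡⟨ cong (_- j /k) (/k-+ j a) ⟩
    j /k + a /k - j /k   ≡⟨ p+q-p≡q (j /k) (a /k) ⟩
    a /k                 ∎
    where open ≤-Reasoning
  value-above-diagonal j (a , slant) {x} _ =
    ≤-reflexive (cong (λ b → b /k - x) (trans (ℕ.+-comm j (suc a)) (sym (ℕ.+-suc a j))))

  top≤-from-interior : ∀ j p {x a} → x < suc j /k → value j p x ≤ a /k → top p ℕ.≤ a
  top≤-from-interior j (b , flat)  _  b/k≤a/k = /k-cancel-≤ b/k≤a/k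
  top≤-from-interior j (b , slant) x< value≤  = /k-cancel-< (<-≤-trans (bottom<value-slant j b x<) value≤)

  flat-if-constant : ∀ j p {x y c} → x < y → value j p x ≡ c /k → value j p y ≡ c /k → p ≡ (c , flat)
  flat-if-constant j (b , flat)  _   b≡c _    = cong (_, flat) (/k-injective b≡c)
  flat-if-constant j (b , slant) x<y vx≡c vy≡c =
    contradiction (trans vy≡c (sym vx≡c)) (<⇒≢ (value-slant-strict j b x<y))

  value-injective : ∀ j p q {x} → x < suc j /k → value j p x ≡ value j q x →
                    value j p (suc j /k) ≡ value j q (suc j /k) → p ≡ q
  value-injective j p q x< vx vr
    with /k-injective (trans (sym (value-right j p)) (trans vr (value-right j q)))
  value-injective j (a , flat)  (.a , flat)  x< vx vr | refl = refl
  value-injective j (a , slant) (.a , slant) x< vx vr | refl = refl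
  value-injective j (a , flat)  (.a , slant) x< vx vr | refl =
    contradiction vx (<⇒≢ (bottom<value-slant j a x<))
  value-injective j (a , slant) (.a , flat)  x< vx vr | refl =
    contradiction (sym vx) (<⇒≢ (bottom<value-slant j a x<))

  slope : Shape → ℤ
  slope flat  = + 0
  slope slant = -[1+ 0 ]

  slope≤0 : ∀ s → slope s ℤ.≤ + 0
  slope≤0 flat  = ℤ.+≤+ z≤n
  slope≤0 slant = ℤ.-≤+

  value-affine : ∀ j p → Σ ℚ λ c → ∀ x → value j p x ≡ c + ℤtoℚ (slope (shape p)) * x
  value-affine j (a , flat)  = a /k , p≡p+0*q (a /k)
    where
    p≡p+0*q : ∀ p q → p ≡ p + 0ℚ * q
    p≡p+0*q = solve-∀ ℚ-ring
  value-affine j (a , slant) = (a ℕ.+ suc j) /k , p-q≡p+-1*q ((a ℕ.+ suc j) /k)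
    where
    p-q≡p+-1*q : ∀ p q → p - q ≡ p + (- 1ℚ) * q
    p-q≡p+-1*q = solve-∀ ℚ-ring

  value-constOrNeg : ∀ j p → Σ ℚ λ c → (∀ x → value j p x ≡ c) ⊎ (∀ x → value j p x ≡ c - x)
  value-constOrNeg j (a , flat)  = a /k , inj₁ (λ _ → refl)
  value-constOrNeg j (a , slant) = (a ℕ.+ suc j) /k , inj₂ (λ _ → refl)

  staircaseFrom : ℕ → List Piece → ℚ → ℚ
  staircaseFrom j []       x = 0ℚ
  staircaseFrom j (p ∷ ps) x with x ≤? suc j /k
  ... | yes _ = value j p x
  ... | no  _ = staircaseFrom (suc j) ps x

  staircase : List Piece → ℚ → ℚ
  staircase = staircaseFrom 0

  -- Piece 0 also covers the points left of 0.
  record Located (x : ℚ) (j : ℕ) : Set where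
    constructor located
    field
      index<k : j ℕ.< k
      ≤right  : x ≤ suc j /k
      left<   : j ≡ 0 ⊎ j /k < x

  staircaseFrom-located : ∀ i ps m {j x} → m ℕ.+ i ≡ j → m ℕ.< length ps → x ≤ suc j /k →
                          m ≡ 0 ⊎ j /k < x → staircaseFrom i ps x ≡ value j (pieceAt ps m) x
  staircaseFrom-located i (p ∷ ps) zero {x = x} refl _ x≤ _ with x ≤? suc i /k
  ... | yes _  = refl
  ... | no  x≰ = contradiction x≤ x≰
  staircaseFrom-located i (p ∷ ps) (suc m) {j} {x} m+i≡j (s≤s m<) x≤ (inj₂ j/k<x) with x ≤? suc i /k
  ... | yes x≤′ = contradiction (≤-trans x≤′ (/k-mono-≤ i<j)) (<⇒≱ j/k<x)
    where
    i<j : suc i ℕ.≤ j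
    i<j = subst (suc i ℕ.≤_) m+i≡j (s≤s (ℕ.m≤n+m i m))
  ... | no  _   = staircaseFrom-located (suc i) ps m (trans (ℕ.+-suc m i) m+i≡j) m< x≤ (inj₂ j/k<x)

  staircase-located : ∀ ps {j x} → j ℕ.< length ps → x ≤ suc j /k → j ≡ 0 ⊎ j /k < x →
                      staircase ps x ≡ value j (pieceAt ps j) x
  staircase-located ps     j< x≤ (inj₁ refl)  = staircaseFrom-located 0 ps 0 refl j< x≤ (inj₁ refl)
  staircase-located ps {j} j< x≤ (inj₂ j/k<x) =
    staircaseFrom-located 0 ps j (ℕ.+-identityʳ j) j< x≤ (inj₂ j/k<x)

  locate : ∀ {x} → x ≤ 1ℚ → ∃ (Located x)
  locate {x} x≤1 = search n ℕ.≤-refl (subst (x ≤_) (sym k/k≡1) x≤1)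
    where
    search : ∀ m → m ℕ.< k → x ≤ suc m /k → ∃ (Located x)
    search zero    m<k x≤ = 0 , located m<k x≤ (inj₁ refl)
    search (suc m) m<k x≤ with x ≤? suc m /k
    ... | yes x≤′ = search m (ℕ.<-trans (ℕ.n<1+n m) m<k) x≤′
    ... | no  x≰  = suc m , located m<k x≤ (inj₂ (≰⇒> x≰))

  Located-left≤ : ∀ {x j} → 0ℚ ≤ x → Located x j → j /k ≤ x
  Located-left≤ {x} 0≤x (located _ _ (inj₁ refl)) = subst (_≤ x) (sym 0/k≡0) 0≤x
  Located-left≤     0≤x (located _ _ (inj₂ j/k<x)) = <⇒≤ j/k<x

  Located-right-end : ∀ {j} → j ℕ.< k → Located (suc j /k) j
  Located-right-end {j} j<k = located j<k ≤-refl (inj₂ (/k-mono-< (ℕ.n<1+n j)))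

  Located-mono : ∀ {x y i j} → Located x i → Located y j → x ≤ y → i ℕ.≤ j
  Located-mono (located _ _ (inj₁ refl))  _                x≤y = z≤n
  Located-mono (located _ _ (inj₂ i/k<x)) (located _ y≤ _) x≤y =
    ℕ.≤-pred (/k-cancel-< (<-≤-trans i/k<x (≤-trans x≤y y≤)))

  Located-leftwards : ∀ {a j} → Located a j →
                      ∃ λ δ → 0ℚ < δ × (∀ x → x ≤ a → a - x < δ → Located x j)
  Located-leftwards (located j<k a≤ (inj₁ refl)) =
    1ℚ , positive⁻¹ 1ℚ , λ x x≤a _ → located j<k (≤-trans x≤a a≤) (inj₁ refl)
  Located-leftwards {a} {j} (located j<k a≤ (inj₂ j/k<a)) =
    a - j /k , p<q⇒0<q-p j/k<a ,
    λ x x≤a a-x< → located j<k (≤-trans x≤a a≤) (inj₂ (p-q<p-r⇒r<q {a} a-x<))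

  locate-halfOpen : ∀ {x} → 0ℚ ≤ x → x < 1ℚ → ∃ λ j → j ℕ.< k × j /k ≤ x × x < suc j /k
  locate-halfOpen {x} 0≤x x<1 with locate (<⇒≤ x<1)
  ... | j , L@(located j<k x≤ _) with x <? suc j /k
  ...   | yes x<  = j , j<k , Located-left≤ 0≤x L , x<
  ...   | no  x≮  = suc j , /k-cancel-< (≤-<-trans (≮⇒≥ x≮) (subst (x <_) (sym k/k≡1) x<1)) ,
                    ≮⇒≥ x≮ , ≤-<-trans x≤ (/k-mono-< (ℕ.n<1+n (suc j)))

  inPiece : ∀ {j y} → j /k < y → y < suc j /k → InPiece k (suc j) y
  inPiece {j} {y} j/k<y y<r = subst (_< y) (sym (grid≡/k j)) j/k<y , subst (y <_) (sym (grid≡/k (suc j))) y<r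

  staircase-injective : ∀ {P Q} → length P ≡ k → length Q ≡ k →
                        SameOn01 (staircase P) (staircase Q) → P ≡ Q
  staircase-injective {P} {Q} |P|≡k |Q|≡k same = pieceAt-ext (trans |P|≡k (sym |Q|≡k)) pieces-agree
    where
    values-agree : ∀ {j y} → Located y j → 0ℚ ≤ y → value j (pieceAt P j) y ≡ value j (pieceAt Q j) y
    values-agree {j} {y} (located j<k y≤ left) 0≤y = begin
      value j (pieceAt P j) y  ≡⟨ staircase-located P (subst (j ℕ.<_) (sym |P|≡k) j<k) y≤ left ⟨
      staircase P y            ≡⟨ same y (0≤y , ≤-trans y≤ (proj₂ (Dom-/k j<k))) ⟩
      staircase Q y            ≡⟨ staircase-located Q (subst (j ℕ.<_) (sym |Q|≡k) j<k) y≤ left ⟩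
      value j (pieceAt Q j) y  ∎
      where open ≡-Reasoning
    pieces-agree : ∀ j → j ℕ.< length P → pieceAt P j ≡ pieceAt Q j
    pieces-agree j j<|P| =
      let j<k = subst (j ℕ.<_) |P|≡k j<|P|
          x , j/k<x , x<r = <-dense (/k-mono-< (ℕ.n<1+n j))
      in value-injective j (pieceAt P j) (pieceAt Q j) x<r
           (values-agree (located j<k (<⇒≤ x<r) (inj₂ j/k<x))
                         (proj₁ (Dom-between (ℕ.<⇒≤ j<k) j<k j/k<x x<r)))
           (values-agree (Located-right-end j<k) (proj₁ (Dom-/k j<k)))

  module Sound {ps : List Piece} (adm : Admissible n k ps) where

    code : List Piece
    code = (k , flat) ∷ ps

    f : ℚ → ℚ
    f = staircase code

    f-located : ∀ {x j} → Located x j → f x ≡ value j (pieceAt code j) x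
    f-located {j = j} (located j<k x≤ left) =
      staircase-located code (subst (j ℕ.<_) (sym (cong suc (Admissible-length adm))) j<k) x≤ left

    f-right-end : ∀ {j} → j ℕ.< k → f (suc j /k) ≡ bottom (pieceAt code j) /k
    f-right-end {j} j<k = trans (f-located (Located-right-end j<k)) (value-right j (pieceAt code j))

    f-bounds : ∀ {x j} → 0ℚ ≤ x → Located x j →
               bottom (pieceAt code j) /k ≤ f x × f x ≤ top (pieceAt code j) /k
    f-bounds {x} {j} 0≤x L@(located _ x≤ _) rewrite f-located L =
      bottom≤value j (pieceAt code j) x≤ , value≤top j (pieceAt code j) (Located-left≤ 0≤x L)

    code-descending : ∀ {i j} → i ℕ.< j → j ℕ.< k → top (pieceAt code j) ℕ.≤ bottom (pieceAt code i)
    code-descending {zero}  {suc j} _         (s≤s j<n) = Admissible-top≤ adm j<n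
    code-descending {suc i} {suc j} (s≤s i<j) (s≤s j<n) = Admissible-descending adm i<j j<n

    code-top≤k : ∀ {j} → j ℕ.< k → top (pieceAt code j) ℕ.≤ k
    code-top≤k {zero}  _   = ℕ.≤-refl
    code-top≤k {suc j} j<k = code-descending (s≤s z≤n) j<k

    code-above : ∀ {j} → 0 ℕ.< j → j ℕ.< k → k ℕ.< j ℕ.+ top (pieceAt code j)
    code-above {suc j} _ (s≤s j<n) = s≤s (Admissible-above adm j<n)

    code-last-positive : 0 ℕ.< bottom (pieceAt code n)
    code-last-positive = last-positive adm
      where
      last-positive : ∀ {m qs} → Admissible m (suc m) qs → 0 ℕ.< bottom (pieceAt ((suc m , flat) ∷ qs) m)
      last-positive {zero}  _    = s≤s z≤n
      last-positive {suc m} adm′ = Admissible-last adm′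

    into01 : MapsInto01 f
    into01 x (0≤x , x≤1) with locate x≤1
    ... | j , L@(located j<k _ _) =
      ≤-trans (0≤/k (bottom (pieceAt code j))) (proj₁ (f-bounds 0≤x L)) ,
      ≤-trans (proj₂ (f-bounds 0≤x L))
              (subst (top (pieceAt code j) /k ≤_) k/k≡1 (/k-mono-≤ (code-top≤k j<k)))

    decreasing : Decreasing f
    decreasing x y (0≤x , x≤1) (0≤y , y≤1) x≤y with locate x≤1 | locate y≤1
    ... | i , Lx | j , Ly with ℕ.m≤n⇒m<n∨m≡n (Located-mono Lx Ly x≤y)
    ... | inj₁ i<j = begin
      f y                         ≤⟨ proj₂ (f-bounds 0≤y Ly) ⟩
      top (pieceAt code j) /k     ≤⟨ /k-mono-≤ (code-descending i<j (Located.index<k Ly)) ⟩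
      bottom (pieceAt code i) /k  ≤⟨ proj₁ (f-bounds 0≤x Lx) ⟩
      f x                         ∎
      where open ≤-Reasoning
    ... | inj₂ refl =
      subst₂ _≤_ (sym (f-located Ly)) (sym (f-located Lx)) (value-antitone i (pieceAt code i) x≤y)

    piecewise : PiecewiseLinear f
    piecewise = gridPoints , affine-between
      where
      gridPoints : List ℚ
      gridPoints = applyUpTo (λ j → suc j /k) k
      affine-between : ∀ x z → Dom x → Dom z → x < z →
                       (∀ p → p ∈ gridPoints → ¬ (x ≤ p × p ≤ z)) →
                       Σ ℚ λ m → Σ ℚ λ c → ∀ y → x ≤ y → y ≤ z → f y ≡ c + m * y
      affine-between x z (_ , x≤1) _ _ avoids with locate x≤1
      ... | j , located j<k x≤ left with value-affine j (pieceAt code j)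
      ... | c , affine = ℤtoℚ (slope (shape (pieceAt code j))) , c , λ y x≤y y≤z →
        trans (f-located (located j<k (≤-trans y≤z (<⇒≤ z<))
                                      (Sum.map₂ (λ j/k<x → <-≤-trans j/k<x x≤y) left)))
              (affine y)
        where
        z< : z < suc j /k
        z< = ≰⇒> (λ r≤z → avoids (suc j /k) (∈-applyUpTo⁺ (λ j → suc j /k) j<k) (x≤ , r≤z))

    oneNearZero : Σ ℚ λ ε → (0ℚ < ε) × (∀ x → 0ℚ ≤ x → x < ε → f x ≡ 1ℚ)
    oneNearZero = 1 /k , 0</k (s≤s z≤n) , λ x _ x<1/k →
      trans (f-located (located (s≤s z≤n) (<⇒≤ x<1/k) (inj₁ refl))) k/k≡1

    positiveAt1 : 0ℚ < f 1ℚ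
    positiveAt1 = subst (0ℚ <_) (trans (sym (f-right-end ℕ.≤-refl)) (cong f k/k≡1)) (0</k code-last-positive)

    right-limit-above-diagonal : ∀ {j a} → j ℕ.< k → 0ℚ < a → j /k ≤ a → 1ℚ - a < value j (pieceAt code j) a
    right-limit-above-diagonal {zero}  {a} _   0<a _     = subst (1ℚ - a <_) (sym k/k≡1) (p-q<p 0<a)
    right-limit-above-diagonal {suc i} {a} j<k _   j/k≤a = begin-strict
      1ℚ - a                         ≡⟨ cong (_- a) k/k≡1 ⟨
      k /k - a                       <⟨ +-monoˡ-< (- a) (/k-mono-< (code-above (s≤s z≤n) j<k)) ⟩
      (suc i ℕ.+ top p) /k - a       ≤⟨ value-above-diagonal (suc i) p j/k≤a ⟩
      value (suc i) p a              ∎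
      where
      open ≤-Reasoning
      p = pieceAt code (suc i)

    rightLimits : ∀ a → 0ℚ < a → a < 1ℚ → Σ ℚ λ L → RightLimit f a L × (1ℚ - a < L)
    rightLimits a 0<a a<1 with locate-halfOpen (<⇒≤ 0<a) a<1
    ... | j , j<k , j/k≤a , a< = value j p a , limit , right-limit-above-diagonal j<k 0<a j/k≤a
      where
      p = pieceAt code j
      limit : RightLimit f a (value j p a)
      limit ε 0<ε = ε ⊓ (suc j /k - a) , ⊓-glb-< 0<ε (p<q⇒0<q-p a<) , close
        where
        close : ∀ x → a < x → x < a + ε ⊓ (suc j /k - a) → x ≤ 1ℚ → ∣ f x - value j p a ∣ < ε
        close x a<x x<a+δ _ = begin-strict
          ∣ f x - value j p a ∣          ≡⟨ cong (λ y → ∣ y - value j p a ∣) (f-located Lx) ⟩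
          ∣ value j p x - value j p a ∣  ≤⟨ value-1-Lipschitz j p x a ⟩
          ∣ x - a ∣                      ≡⟨ ∣p-q∣≡p-q (<⇒≤ a<x) ⟩
          x - a                          <⟨ p<q+r⇒p-q<r x<a+δ ⟩
          ε ⊓ (suc j /k - a)             ≤⟨ p⊓q≤p ε _ ⟩
          ε                              ∎
          where
          open ≤-Reasoning
          x≤ : x ≤ suc j /k
          x≤ = <⇒≤ (<-≤-trans x<a+δ (subst (a + ε ⊓ (suc j /k - a) ≤_) (p+[q-p]≡q a (suc j /k))
                                          (+-monoʳ-≤ a (p⊓q≤q ε _))))
          Lx : Located x j
          Lx = located j<k x≤ (inj₂ (≤-<-trans j/k≤a a<x))

    integral : ∀ i → 1 ℕ.≤ i → i ℕ.≤ k → Σ ℤ λ z → ℤtoℚ (+ k) * f (grid k i) ≡ ℤtoℚ z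
    integral (suc j) _ j<k = + bottom (pieceAt code j) , (begin
      ℤtoℚ (+ k) * f (grid k (suc j))          ≡⟨ cong (λ y → ℤtoℚ (+ k) * f y) (grid≡/k (suc j)) ⟩
      ℤtoℚ (+ k) * f (suc j /k)                ≡⟨ cong (ℤtoℚ (+ k) *_) (f-right-end j<k) ⟩
      ℤtoℚ (+ k) * bottom (pieceAt code j) /k  ≡⟨ k*[a/k]≡a (bottom (pieceAt code j)) ⟩
      ℤtoℚ (+ bottom (pieceAt code j))         ∎)
      where open ≡-Reasoning

    usc : UpperSemicontinuous f
    usc a (0≤a , a≤1) ε 0<ε with locate a≤1
    ... | j , La with Located-leftwards La
    ... | δ , 0<δ , leftwards = ε ⊓ δ , ⊓-glb-< 0<ε 0<δ , below
      where
      p = pieceAt code j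
      below : ∀ x → Dom x → ∣ x - a ∣ < ε ⊓ δ → f x < f a + ε
      below x (0≤x , x≤1) ∣x-a∣< with a ≤? x
      ... | yes a≤x = ≤-<-trans (decreasing a x (0≤a , a≤1) (0≤x , x≤1) a≤x) (p<p+q 0<ε)
      ... | no  a≰x = p-q<r⇒p<q+r (begin-strict
        f x - f a                      ≤⟨ p≤∣p∣ (f x - f a) ⟩
        ∣ f x - f a ∣                  ≡⟨ cong₂ (λ u v → ∣ u - v ∣) (f-located Lx) (f-located La) ⟩
        ∣ value j p x - value j p a ∣  ≤⟨ value-1-Lipschitz j p x a ⟩
        ∣ x - a ∣                      <⟨ ∣x-a∣< ⟩
        ε ⊓ δ                          ≤⟨ p⊓q≤p ε δ ⟩
        ε                              ∎)
        where
        open ≤-Reasoning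
        Lx : Located x j
        Lx = leftwards x (<⇒≤ (≰⇒> a≰x))
                       (≤-<-trans (q-p≤∣p-q∣ x a) (<-≤-trans ∣x-a∣< (p⊓q≤q ε δ)))

    f-inPiece : ∀ {j x} → j ℕ.< k → InPiece k (suc j) x → f x ≡ value j (pieceAt code j) x
    f-inPiece {j} {x} j<k (j/k<x , x<) =
      f-located (located j<k (<⇒≤ (subst (x <_) (grid≡/k (suc j)) x<))
                             (inj₂ (subst (_< x) (grid≡/k j) j/k<x)))

    pieceSlope : ∀ i → 1 ℕ.≤ i → i ℕ.≤ k → Σ ℤ λ s → (s ℤ.≤ + 0) × Σ ℚ λ c →
                 ∀ x → InPiece k i x → f x ≡ c + ℤtoℚ s * x
    pieceSlope (suc j) _ j<k with value-affine j (pieceAt code j)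
    ... | c , affine = slope (shape (pieceAt code j)) , slope≤0 (shape (pieceAt code j)) , c ,
                       λ x x∈ → trans (f-inPiece j<k x∈) (affine x)

    constOrNeg : ∀ i → 1 ℕ.≤ i → i ℕ.≤ k → Σ ℚ λ c →
                 (∀ x → InPiece k i x → f x ≡ c) ⊎ (∀ x → InPiece k i x → f x ≡ c - x)
    constOrNeg (suc j) _ j<k with value-constOrNeg j (pieceAt code j)
    ... | c , inj₁ const = c , inj₁ (λ x x∈ → trans (f-inPiece j<k x∈) (const x))
    ... | c , inj₂ down  = c , inj₂ (λ x x∈ → trans (f-inPiece j<k x∈) (down x))

    staircase-InSC : InSC k f
    staircase-InSC = record
      { inPtilde = record
        { inP = record
          { into01      = into01
          ; decreasing  = decreasing
          ; piecewise   = piecewise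
          ; oneNearZero = oneNearZero
          ; positiveAt1 = positiveAt1
          ; rightLimits = rightLimits
          }
        ; integral   = integral
        ; usc        = usc
        ; pieceSlope = pieceSlope
        }
      ; constOrNeg = constOrNeg
      }

  module Complete {f : ℚ → ℚ} (sc : InSC k f) where
    open InSC sc using (inPtilde; constOrNeg)
    open InPtilde inPtilde using (inP; integral; usc)
    open InP inP using (into01; decreasing; oneNearZero; rightLimits)

    ConstOrNeg : ℕ → Set
    ConstOrNeg i = Σ ℚ λ c → (∀ x → InPiece k i x → f x ≡ c)
                            ⊎ (∀ x → InPiece k i x → f x ≡ c - x)

    shapeOf : ∀ {i} → ConstOrNeg i → Shape
    shapeOf (_ , inj₁ _) = flat
    shapeOf (_ , inj₂ _) = slant

    pieceOf : ∀ {j} → j ℕ.< k → Piece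
    pieceOf {j} j<k = ℤ.∣ proj₁ (integral (suc j) (s≤s z≤n) j<k) ∣ ,
                      shapeOf {suc j} (constOrNeg (suc j) (s≤s z≤n) j<k)

    pieceOf-right-end : ∀ {j} (j<k : j ℕ.< k) → f (suc j /k) ≡ bottom (pieceOf j<k) /k
    pieceOf-right-end {j} j<k = k*q≡z⇒q≡∣z∣/k {z = proj₁ (integral (suc j) (s≤s z≤n) j<k)}
      (proj₁ (into01 (suc j /k) (Dom-/k j<k)))
      (trans (cong (λ y → ℤtoℚ (+ k) * f y) (sym (grid≡/k (suc j))))
             (proj₂ (integral (suc j) (s≤s z≤n) j<k)))

    agree-on-piece : ∀ {j} {g : ℚ → ℚ} → j ℕ.< k → SlopeIn[-1,0] g → (∀ x → InPiece k (suc j) x → f x ≡ g x) →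
                     ∀ x → j /k < x → x ≤ suc j /k → f x ≡ g x
    agree-on-piece {j} {g} j<k g-slope agree x l<x x≤r with x <? suc j /k
    ... | yes x<r = agree x (inPiece l<x x<r)
    ... | no  x≮r = subst (λ y → f y ≡ g y) (≤-antisym (≮⇒≥ x≮r) x≤r)
      (agree-at-right-end decreasing usc g-slope (Dom-/k (ℕ.<⇒≤ j<k)) (Dom-/k j<k)
        (/k-mono-< (ℕ.n<1+n j)) (λ y l<y y<r → agree y (inPiece l<y y<r)))

    pieceOf-agrees : ∀ {j x} (j<k : j ℕ.< k) → j /k < x → x ≤ suc j /k → f x ≡ value j (pieceOf j<k) x
    pieceOf-agrees {j} j<k = agrees (constOrNeg (suc j) (s≤s z≤n) j<k)
      where
      r = suc j /k
      b = bottom (pieceOf j<k)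
      l<r = /k-mono-< (ℕ.n<1+n j)
      agrees : (choice : ConstOrNeg (suc j)) → ∀ {x} → j /k < x → x ≤ r →
               f x ≡ value j (b , shapeOf {suc j} choice) x
      agrees (c , inj₁ const) {x} l<x x≤r = trans (extend x l<x x≤r) c≡b/k
        where
        extend : ∀ x → j /k < x → x ≤ r → f x ≡ c
        extend = agree-on-piece {g = λ _ → c} j<k (λ x≤y → ≤-refl , p≤p+q (p≤q⇒0≤q-p x≤y)) const
        c≡b/k : c ≡ b /k
        c≡b/k = trans (sym (extend r l<r ≤-refl)) (pieceOf-right-end j<k)
      agrees (c , inj₂ down) {x} l<x x≤r = trans (extend x l<x x≤r) (cong (_- x) c≡)
        where
        extend : ∀ x → j /k < x → x ≤ r → f x ≡ c - x
        extend = agree-on-piece {g = λ y → c - y} j<k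
          (λ {x} {y} x≤y → +-monoʳ-≤ c (neg-antimono-≤ x≤y) , ≤-reflexive (sym (p-q+[q-r]≡p-r c y x))) down
        c≡ : c ≡ (b ℕ.+ suc j) /k
        c≡ = begin
          c                 ≡⟨ p-q+q≡p c r ⟨
          c - r + r         ≡⟨ cong (_+ r) (trans (sym (extend r l<r ≤-refl)) (pieceOf-right-end j<k)) ⟩
          b /k + r          ≡⟨ /k-+ b (suc j) ⟨
          (b ℕ.+ suc j) /k  ∎
          where open ≡-Reasoning

    -- (0 , flat) is a junk value, used only for j ≥ k.
    piece : ℕ → Piece
    piece j with j ℕ.<? k
    ... | yes j<k = pieceOf j<k
    ... | no  _   = 0 , flat

    piece≡pieceOf : ∀ {j} (j<k : j ℕ.< k) → piece j ≡ pieceOf j<k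
    piece≡pieceOf {j} j<k with j ℕ.<? k
    ... | yes j<k′ = cong pieceOf (ℕ.<-irrelevant j<k′ j<k)
    ... | no  j≮k  = contradiction j<k j≮k

    f-right-end : ∀ {j} → j ℕ.< k → f (suc j /k) ≡ bottom (piece j) /k
    f-right-end {j} j<k =
      subst (λ p → f (suc j /k) ≡ bottom p /k) (sym (piece≡pieceOf j<k)) (pieceOf-right-end j<k)

    f-on-piece : ∀ {j x} → j ℕ.< k → j /k < x → x ≤ suc j /k → f x ≡ value j (piece j) x
    f-on-piece {j} {x} j<k l<x x≤r =
      subst (λ p → f x ≡ value j p x) (sym (piece≡pieceOf j<k)) (pieceOf-agrees j<k l<x x≤r)

    piece-0 : piece 0 ≡ (k , flat)
    piece-0 =
      let ε , 0<ε , one = oneNearZero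
          x , 0<x , x<min = <-dense (⊓-glb-< 0<ε (0</k {1} (s≤s z≤n)))
          y , 0<y , y<x = <-dense 0<x
          x<ε = <-≤-trans x<min (p⊓q≤p ε (1 /k))
          x≤1/k = <⇒≤ (<-≤-trans x<min (p⊓q≤q ε (1 /k)))
      in flat-if-constant 0 (piece 0) y<x
           (value-is-1 0<y (≤-trans (<⇒≤ y<x) x≤1/k) (one y (<⇒≤ 0<y) (<-trans y<x x<ε)))
           (value-is-1 0<x x≤1/k (one x (<⇒≤ 0<x) x<ε))
      where
      value-is-1 : ∀ {z} → 0ℚ < z → z ≤ 1 /k → f z ≡ 1ℚ → value 0 (piece 0) z ≡ k /k
      value-is-1 {z} 0<z z≤1/k fz≡1 = begin
        value 0 (piece 0) z  ≡⟨ f-on-piece (s≤s z≤n) (subst (_< z) (sym 0/k≡0) 0<z) z≤1/k ⟨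
        f z                  ≡⟨ fz≡1 ⟩
        1ℚ                   ≡⟨ k/k≡1 ⟨
        k /k                 ∎
        where open ≡-Reasoning

    piece-descending : ∀ {j} → suc j ℕ.< k → top (piece (suc j)) ℕ.≤ bottom (piece j)
    piece-descending {j} sj<k =
      let j<k = ℕ.<-trans (ℕ.n<1+n j) sj<k
          x , r<x , x<r′ = <-dense (/k-mono-< (ℕ.n<1+n (suc j)))
      in top≤-from-interior (suc j) (piece (suc j)) x<r′ (begin
        value (suc j) (piece (suc j)) x
          ≡⟨ f-on-piece sj<k r<x (<⇒≤ x<r′) ⟨
        f x
          ≤⟨ decreasing (suc j /k) x (Dom-/k j<k) (Dom-between j<k sj<k r<x x<r′) (<⇒≤ r<x) ⟩
        f (suc j /k)
          ≡⟨ f-right-end j<k ⟩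
        bottom (piece j) /k
          ∎)
      where open ≤-Reasoning

    piece-above : ∀ {j} → suc j ℕ.< k → k ℕ.≤ j ℕ.+ top (piece (suc j))
    piece-above {j} sj<k =
      let L , limit , 1-a<L = rightLimits a (0</k (s≤s z≤n)) (subst (a <_) k/k≡1 (/k-mono-< sj<k))
          L≤top = RightLimit-≤ limit (/k-mono-< (ℕ.n<1+n (suc j))) (proj₂ (Dom-/k sj<k)) f≤top
      in ℕ.≤-pred (/k-cancel-< (begin-strict
        k /k                                ≡⟨ k/k≡1 ⟩
        1ℚ                                  <⟨ p-q<r⇒p<q+r {q = a} 1-a<L ⟩
        a + L                               ≤⟨ +-monoʳ-≤ a L≤top ⟩
        a + top (piece (suc j)) /k          ≡⟨ /k-+ (suc j) (top (piece (suc j))) ⟨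
        (suc j ℕ.+ top (piece (suc j))) /k  ∎))
      where
      open ≤-Reasoning
      a = suc j /k
      f≤top : ∀ x → a < x → x < suc (suc j) /k → f x ≤ top (piece (suc j)) /k
      f≤top x a<x x<b = subst (_≤ top (piece (suc j)) /k) (sym (f-on-piece sj<k a<x (<⇒≤ x<b)))
                              (value≤top (suc j) (piece (suc j)) (<⇒≤ a<x))

    tailCode : List Piece
    tailCode = applyUpTo (λ j → piece (suc j)) n

    tailCode-admissible : Admissible n k tailCode
    tailCode-admissible = applyUpTo-admissible n (λ j → piece (suc j))
      (λ 0<n → subst (λ p → top (piece 1) ℕ.≤ bottom p) piece-0 (piece-descending (s≤s 0<n)))
      (λ j sj<n → piece-descending (s≤s sj<n))
      (λ j j<n → piece-above (s≤s j<n))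

    f-located : ∀ {x j} → 0ℚ ≤ x → Located x j → f x ≡ value j (piece j) x
    f-located 0≤x (located j<k x≤ (inj₂ j/k<x)) = f-on-piece j<k j/k<x x≤
    f-located {x} 0≤x (located j<k x≤ (inj₁ refl)) with 0ℚ <? x
    ... | yes 0<x = f-on-piece j<k (subst (_< x) (sym 0/k≡0) 0<x) x≤
    ... | no  0≮x =
      let ε , 0<ε , one = oneNearZero
          x≡0 = ≤-antisym (≮⇒≥ 0≮x) 0≤x
      in begin
        f x                   ≡⟨ one x 0≤x (subst (_< ε) (sym x≡0) 0<ε) ⟩
        1ℚ                    ≡⟨ k/k≡1 ⟨
        value 0 (k , flat) x  ≡⟨ cong (λ p → value 0 p x) piece-0 ⟨
        value 0 (piece 0) x   ∎
      where open ≡-Reasoning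

    f≡staircase : SameOn01 f (staircase ((k , flat) ∷ tailCode))
    f≡staircase x (0≤x , x≤1) with locate x≤1
    ... | j , L@(located j<k x≤ left) = begin
      f x                                        ≡⟨ f-located 0≤x L ⟩
      value j (piece j) x                        ≡⟨ cong (λ p → value j p x) (pieceAt-applyUpTo piece j<k) ⟨
      value j (pieceAt (applyUpTo piece k) j) x  ≡⟨ staircase-located (applyUpTo piece k) j<length x≤ left ⟨
      staircase (applyUpTo piece k) x            ≡⟨ cong (λ P → staircase P x) (cong (_∷ tailCode) piece-0) ⟩
      staircase ((k , flat) ∷ tailCode) x        ∎
      where
      open ≡-Reasoning
      j<length : j ℕ.< length (applyUpTo piece k)
      j<length = subst (j ℕ.<_) (sym (length-applyUpTo piece k)) j<k

AllPairs-restrict : ∀ {A : Set} {P : A → Set} {R S : A → A → Set} {xs} →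
                    (∀ {x y} → P x → P y → R x y → S x y) → All P xs → AllPairs R xs → AllPairs S xs
AllPairs-restrict f []         []         = []
AllPairs-restrict f (px ∷ pxs) (rx ∷ rxs) =
  All.zipWith (λ (py , r) → f px py r) (pxs , rx) ∷ AllPairs-restrict f pxs rxs

SC-cardinality : ∀ n → SCHasCardinality (suc n) (schroeder n)
SC-cardinality n =
  map fromCode codes ,
  trans (length-map fromCode codes) (length-admissibles n 0) ,
  All.map⁺ (All.map Sound.staircase-InSC (admissibles-sound n 0)) ,
  AllPairs.map⁺ (AllPairs-restrict distinct (admissibles-sound n 0) (admissibles-unique n 0)) ,
  λ f sc → Any.map (λ fromCode≡ → subst (SameOn01 f) fromCode≡ (Complete.f≡staircase sc))
                   (∈-map⁺ fromCode (admissibles-complete n 0 (Complete.tailCode-admissible sc)))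
  where
  open Scale n
  open Staircase n
  codes : List (List Piece)
  codes = admissibles n 0
  fromCode : List Piece → ℚ → ℚ
  fromCode ps = staircase ((k , flat) ∷ ps)
  distinct : ∀ {ps qs} → Admissible n k ps → Admissible n k qs → ps ≢ qs →
             ¬ SameOn01 (fromCode ps) (fromCode qs)
  distinct adm adm′ ps≢qs same = ps≢qs (∷-injectiveʳ
    (staircase-injective (cong suc (Admissible-length adm)) (cong suc (Admissible-length adm′)) same))

proposition4p5 : (k : ℕ) → .{{_ : NonZero k}} → SCHasCardinality k (schroeder (k ∸ 1))
proposition4p5 zero    {{k≢0}} = Irrelevant.⊥-elim (NonZero.nonZero k≢0)
proposition4p5 (suc n)         = SC-cardinality n
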